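{- Let $n\ge1$. A $0$-$1$ matrix is the characteristic matrix of a complete non-ambiguous forest with $n$ leaves if and only if it is a $\Gamma$-free $n\times n$ $0$-$1$ matrix with no all-zero rows and no all-zero columns in which every top-$1$ is a leading-$1$. Moreover, in such a matrix the leaves are exactly the top-$1$'s, and the set of positions $(i,j)$ of the leaves (equivalently of the top-$1$'s) is $P_\eta=\{(1,\eta_1),\dots,(n,\eta_n)\}$ for some permutation $\eta=(\eta_1,\dots,\eta_n)$ of $\{1,\dots,n\}$.
   Context: Convention: rows of a matrix are indexed from bottom to top ($1$ is the bottom row) and columns from right to left ($1$ is the rightmost column); position $(i,j)$ means row $i$, column $j$. The characteristic matrix $\chi_A$ of a finite $A\subseteq\mathbb N^+\times\mathbb N^+$ has $\max_{v\in A}x(v)$ rows and $\max_{v\in A}y(v)$ columns and has a $1$ in position $(i,j)$ iff $(i,j)\in A$. A matrix is $\Gamma$-free if there are no two $1$'s in the same row together with a third $1$ strictly below the left one of them in its column. A non-ambiguous forest is a finite $A\subseteq\mathbb N^+\times\mathbb N^+$ such that $\chi_A$ is $\Gamma$-free with no all-zero rows and columns. Its forest structure: the parent of $p\in A$ is the nearest point of $A$ in the same row to the right of $p$ (i.e. same first coordinate, largest smaller second coordinate) if one exists, otherwise the nearest point of $A$ below $p$ in the same column if one exists, otherwise $p$ is a root (at most one of the two candidates exists by $\Gamma$-freeness). Leaves are points with no children; the forest is complete if every point has $0$ or $2$ children. A top-$1$ is a $1$ with no $1$ above it in its column; a leading-$1$ is a $1$ with no $1$ to its left in its row. -}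

module Defs where

open import Data.Nat using (ℕ)
open import Data.Bool using (Bool; true; false)
open import Data.Fin using (Fin; _<_)
open import Data.Product using (Σ; ∃; _×_; _,_)
open import Data.Sum using (_⊎_)
open import Relation.Binary.PropositionalEquality using (_≡_; _≢_)
open import Relation.Nullary using (¬_)

-- Convention: row index zero is the BOTTOM row (row 1 of the paper),
-- column index zero is the RIGHTMOST column (column 1 of the paper).
-- Hence "below" = smaller row index, "to the right" = smaller column index,
-- "to the left" = larger column index.
Mat : ℕ → ℕ → Set
Mat r c = Fin r → Fin c → Bool

module _ {r c : ℕ} (M : Mat r c) where

  One : Fin r → Fin c → Set
  One i j = M i j ≡ true

  ΓFree : Set
  ΓFree = ∀ (i i' : Fin r) (j j' : Fin c) → j < j' → i' < i →
          ¬ (One i j × One i j' × One i' j')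

  NoZeroRows : Set
  NoZeroRows = ∀ (i : Fin r) → ∃ λ (j : Fin c) → One i j

  NoZeroCols : Set
  NoZeroCols = ∀ (j : Fin c) → ∃ λ (i : Fin r) → One i j

  Top1 : Fin r → Fin c → Set
  Top1 i j = One i j × (∀ (k : Fin r) → i < k → M k j ≡ false)

  Leading1 : Fin r → Fin c → Set
  Leading1 i j = One i j × (∀ (k : Fin c) → j < k → M i k ≡ false)

  -- Forest structure on the set of 1's (the set A with χ_A = M).
  -- Parent (i,j) (i',j') : the point (i',j') is the parent of (i,j).
  Parent : Fin r → Fin c → Fin r → Fin c → Set
  Parent i j i' j' =
    One i j × One i' j' ×
    ( (i' ≡ i × j' < j × (∀ (k : Fin c) → j' < k → k < j → M i k ≡ false))
    ⊎ ((∀ (k : Fin c) → k < j → M i k ≡ false) ×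
       j' ≡ j × i' < i × (∀ (k : Fin r) → i' < k → k < i → M k j ≡ false)) )

  Leaf : Fin r → Fin c → Set
  Leaf i j = One i j × (∀ (k : Fin r) (l : Fin c) → ¬ Parent k l i j)

  TwoChildren : Fin r → Fin c → Set
  TwoChildren i j =
    Σ (Fin r × Fin c) λ { (k₁ , l₁) → Σ (Fin r × Fin c) λ { (k₂ , l₂) →
      Parent k₁ l₁ i j × Parent k₂ l₂ i j × (k₁ , l₁) ≢ (k₂ , l₂) ×
      (∀ (k : Fin r) (l : Fin c) → Parent k l i j →
         (k , l) ≡ (k₁ , l₁) ⊎ (k , l) ≡ (k₂ , l₂)) } }

  Complete : Set
  Complete = ∀ (i : Fin r) (j : Fin c) → One i j → Leaf i j ⊎ TwoChildren i j

  HasLeaves : ℕ → Set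
  HasLeaves n =
    Σ (Fin n → Fin r × Fin c) λ f →
      (∀ (a b : Fin n) → f a ≡ f b → a ≡ b) ×
      (∀ (a : Fin n) → Leaf (Data.Product.proj₁ (f a)) (Data.Product.proj₂ (f a))) ×
      (∀ (i : Fin r) (j : Fin c) → Leaf i j → ∃ λ (a : Fin n) → f a ≡ (i , j))

  IsNAFMatrix : Set
  IsNAFMatrix = ΓFree × NoZeroRows × NoZeroCols

  IsCompleteNAFMatrix : ℕ → Set
  IsCompleteNAFMatrix n = IsNAFMatrix × Complete × HasLeaves n

  TopOnesLeading : Set
  TopOnesLeading = ∀ (i : Fin r) (j : Fin c) → Top1 i j → Leading1 i j

-- A 1 at (i, j) has at most two children: a row child, the nearest 1 to its left, and a
-- column child, the nearest 1 above it (provided that 1 has no 1 to its right). A top-1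
-- has no column child and a leading-1 no row child, so in a complete forest top-1's and
-- leading-1's are leaves; conversely a leaf is leading, and by Γ-freeness also top. Hence
-- the leaves are the top-1's, one per column, and the leading-1's, one per row, which forces
-- an n × n matrix. Conversely, in a square matrix whose top-1's are leading, the map sending
-- a column to the row of its top-1 is injective, hence bijective, so every leading-1 is a
-- top-1; a 1 that is not leading has a row child and is not top, and Γ-freeness turns the
-- nearest 1 above it into its column child. The leaves are then the positions (i, η i),
-- where η i is the column of the leading-1 of row i.
module Submission where

open import Defs
open import Data.Nat using (ℕ; _≤_)
open import Data.Fin using (Fin)
open import Data.Fin.Permutation using (Permutation′; _⟨$⟩ʳ_)
open import Data.Product using (Σ; _×_)
open import Function.Bundles using (_⇔_)
open import Relation.Binary.PropositionalEquality using (_≡_)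

open import Data.Bool using (Bool; true; false)
open import Data.Bool.Properties using (not-¬; ¬-not)
import Data.Bool.Properties as Bool
open import Data.Empty using (⊥-elim)
open import Data.Fin using (zero; suc; _<_; punchOut)
open import Data.Fin.Permutation using (permutation)
open import Data.Fin.Properties
  using (_<?_; <-cmp; <-irrefl; any?; punchOut-injective; injective⇒≤; cantor-schröder-bernstein)
import Data.Fin.Properties as Fin
import Data.Nat as ℕ
open import Data.Nat using (s<s⁻¹)
open import Data.Nat.Properties using (1+n≰n)
open import Data.Product using (∃; _,_; proj₁; proj₂; swap)
open import Data.Product.Properties using (×-≡,≡→≡)
open import Data.Sum using (_⊎_; inj₁; inj₂)
open import Function using (_∘_)
open import Function.Bundles using (mk⇔)
open import Function.Definitions using (Injective)
open import Relation.Binary.Definitions using (tri<; tri≈; tri>)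
open import Relation.Binary.PropositionalEquality using (_≢_; refl; sym; trans; cong; subst)
open import Relation.Nullary using (¬_; yes; no)
open import Relation.Nullary.Decidable using (_×-dec_)
open import Relation.Unary using (Pred; Decidable)

least : ∀ {n p} (P : Pred (Fin n) p) → Decidable P → ∃ P →
        ∃ λ k → P k × (∀ k' → k' < k → ¬ P k')
least {ℕ.suc n} P P? (k , pk) with P? zero
least {ℕ.suc n} P P? (k , pk)     | yes p₀ = zero , p₀ , λ _ ()
least {ℕ.suc n} P P? (zero , pk)  | no ¬p₀ = ⊥-elim (¬p₀ pk)
least {ℕ.suc n} P P? (suc k , pk) | no ¬p₀ with least (P ∘ suc) (P? ∘ suc) (k , pk)
... | m , pm , below = suc m , pm , λ where
  zero    _     → ¬p₀
  (suc k') k'<m → below k' (s<s⁻¹ k'<m)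

greatest : ∀ {n p} (P : Pred (Fin n) p) → Decidable P → ∃ P →
           ∃ λ k → P k × (∀ k' → k < k' → ¬ P k')
greatest {ℕ.suc n} P P? (k , pk) with any? (P? ∘ suc)
greatest {ℕ.suc n} P P? (k , pk) | yes ∃p with greatest (P ∘ suc) (P? ∘ suc) ∃p
... | m , pm , above = suc m , pm , λ where
  (suc k') m<k' → above k' (s<s⁻¹ m<k')
greatest {ℕ.suc n} P P? (zero , p₀)  | no ∄p = zero , p₀ , λ where
  (suc k') _ pk' → ∄p (k' , pk')
greatest {ℕ.suc n} P P? (suc k , pk) | no ∄p = ⊥-elim (∄p (k , pk))

<-unique : ∀ {n p} {P : Pred (Fin n) p} → (∀ {a b} → a < b → P a → ¬ P b) →
           ∀ {a b} → P a → P b → a ≡ b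
<-unique excl {a} {b} pa pb with <-cmp a b
... | tri< a<b _ _ = ⊥-elim (excl a<b pa pb)
... | tri≈ _ a≡b _ = a≡b
... | tri> _ _ b<a = ⊥-elim (excl b<a pb pa)

injective⇒surjective : ∀ {n} (f : Fin n → Fin n) → Injective _≡_ _≡_ f → ∀ y → ∃ λ x → f x ≡ y
injective⇒surjective {ℕ.suc n} f f-inj y with any? (λ x → f x Fin.≟ y)
... | yes hit = hit
... | no miss = ⊥-elim (1+n≰n (injective⇒≤ {f = avoid} avoid-injective))
  where
  y≢f : ∀ x → y ≢ f x
  y≢f x y≡fx = miss (x , sym y≡fx)

  avoid : Fin (ℕ.suc n) → Fin n
  avoid x = punchOut (y≢f x)

  avoid-injective : Injective _≡_ _≡_ avoid
  avoid-injective {x} {x'} e = f-inj (punchOut-injective (y≢f x) (y≢f x') e)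

module _ {n : ℕ} (f : Fin n → Bool) where

  Last : Fin n → Set
  Last a = f a ≡ true × (∀ k → a < k → f k ≡ false)

  NextAfter : Fin n → Fin n → Set
  NextAfter x a = x < a × f a ≡ true × (∀ k → x < k → k < a → f k ≡ false)

  last-exists : ∃ (λ a → f a ≡ true) → ∃ Last
  last-exists hit with greatest (λ a → f a ≡ true) (λ a → f a Bool.≟ true) hit
  ... | a , fa , above = a , fa , λ k a<k → ¬-not (above k a<k)

  last-unique : ∀ {a b} → Last a → Last b → a ≡ b
  last-unique = <-unique λ {a} a<b (_ , above) (fb , _) → not-¬ (above _ a<b) fb

  none-after⊎nextAfter : ∀ x → (∀ k → x < k → f k ≡ false) ⊎ ∃ (NextAfter x)
  none-after⊎nextAfter x with any? (λ k → (x <? k) ×-dec (f k Bool.≟ true))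
  ... | no ∄k = inj₁ λ k x<k → ¬-not λ fk → ∄k (k , x<k , fk)
  ... | yes ∃k with least _ (λ k → (x <? k) ×-dec (f k Bool.≟ true)) ∃k
  ...   | a , (x<a , fa) , below =
            inj₂ (a , x<a , fa , λ k x<k k<a → ¬-not λ fk → below k k<a (x<k , fk))

  nextAfter-unique : ∀ {x a b} → NextAfter x a → NextAfter x b → a ≡ b
  nextAfter-unique = <-unique λ a<b (x<a , fa , _) (_ , _ , between) → not-¬ (between _ x<a a<b) fa

module _ {r c : ℕ} (M : Mat r c) where

  column : Fin c → Fin r → Bool
  column j i = M i j

  rowChild : ∀ {i j l} → One M i j → NextAfter (M i) j l → Parent M i l i j
  rowChild oj (j<l , ol , between) = ol , oj , inj₁ (refl , j<l , between)

  columnChild : ΓFree M → ∀ {i j k} → One M i j → NextAfter (column j) i k → Parent M k j i j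
  columnChild Γ {i} {j} {k} oj (i<k , ok , between) = ok , oj , inj₂ (none-right , refl , i<k , between)
    where
    none-right : ∀ m → m < j → M k m ≡ false
    none-right m m<j = ¬-not λ om → Γ k i m j m<j i<k (om , ok , oj)

  top∧leading⇒leaf : ∀ {i j} → Top1 M i j → Leading1 M i j → Leaf M i j
  top∧leading⇒leaf (oj , none-above) (_ , none-left) = oj , λ where
    k l (ok , _ , inj₁ (refl , j<l , _))    → not-¬ (none-left l j<l) ok
    k l (ok , _ , inj₂ (_ , refl , i<k , _)) → not-¬ (none-above k i<k) ok

  leaf⇒leading : ∀ {i j} → Leaf M i j → Leading1 M i j
  leaf⇒leading {i} {j} (oj , childless) with none-after⊎nextAfter (M i) j
  ... | inj₁ none-left = oj , none-left
  ... | inj₂ (l , left) = ⊥-elim (childless i l (rowChild oj left))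

  leaf⇒top : ΓFree M → ∀ {i j} → Leaf M i j → Top1 M i j
  leaf⇒top Γ {i} {j} (oj , childless) with none-after⊎nextAfter (column j) i
  ... | inj₁ none-above = oj , none-above
  ... | inj₂ (k , above) = ⊥-elim (childless k j (columnChild Γ oj above))

  top-unique : ∀ {i i' j} → Top1 M i j → Top1 M i' j → i ≡ i'
  top-unique {j = j} = last-unique (column j)

  leading-unique : ∀ {i j j'} → Leading1 M i j → Leading1 M i j' → j ≡ j'
  leading-unique {i} = last-unique (M i)

  top-exists : NoZeroCols M → ∀ j → ∃ λ i → Top1 M i j
  top-exists nzc j = last-exists (column j) (nzc j)

  leading-exists : NoZeroRows M → ∀ i → ∃ λ j → Leading1 M i j
  leading-exists nzr i = last-exists (M i) (nzr i)

  viaRow : ∀ {i j k l} → Parent M k l i j → Bool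
  viaRow (_ , _ , inj₁ _) = true
  viaRow (_ , _ , inj₂ _) = false

  children-of-same-kind-equal : ∀ {i j k l k' l'} (p : Parent M k l i j) (p' : Parent M k' l' i j) →
                                viaRow p ≡ viaRow p' → (k , l) ≡ (k' , l')
  children-of-same-kind-equal (ol , _ , inj₁ (refl , j<l , between)) (ol' , _ , inj₁ (refl , j<l' , between')) _ =
    cong (_ ,_) (nextAfter-unique (M _) (j<l , ol , between) (j<l' , ol' , between'))
  children-of-same-kind-equal (ok , _ , inj₂ (_ , refl , i<k , between)) (ok' , _ , inj₂ (_ , refl , i<k' , between')) _ =
    cong (_, _) (nextAfter-unique (column _) (i<k , ok , between) (i<k' , ok' , between'))
  children-of-same-kind-equal (_ , _ , inj₁ _) (_ , _ , inj₂ _) ()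
  children-of-same-kind-equal (_ , _ , inj₂ _) (_ , _ , inj₁ _) ()

  ¬twoChildren-of-one-kind : ∀ {i j} b → (∀ {k l} (p : Parent M k l i j) → viaRow p ≡ b) → ¬ TwoChildren M i j
  ¬twoChildren-of-one-kind b kind (_ , _ , p₁ , p₂ , p₁≢p₂ , _) =
    p₁≢p₂ (children-of-same-kind-equal p₁ p₂ (trans (kind p₁) (sym (kind p₂))))

  top⇒children-viaRow : ∀ {i j k l} → Top1 M i j → (p : Parent M k l i j) → viaRow p ≡ true
  top⇒children-viaRow _                (_ , _ , inj₁ _)                 = refl
  top⇒children-viaRow (_ , none-above) (ok , _ , inj₂ (_ , refl , i<k , _)) = ⊥-elim (not-¬ (none-above _ i<k) ok)

  leading⇒children-viaColumn : ∀ {i j k l} → Leading1 M i j → (p : Parent M k l i j) → viaRow p ≡ false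
  leading⇒children-viaColumn (_ , none-left) (ol , _ , inj₁ (refl , j<l , _)) = ⊥-elim (not-¬ (none-left _ j<l) ol)
  leading⇒children-viaColumn _               (_ , _ , inj₂ _)                 = refl

  complete∧top⇒leaf : Complete M → ∀ {i j} → Top1 M i j → Leaf M i j
  complete∧top⇒leaf complete {i} {j} top with complete i j (proj₁ top)
  ... | inj₁ leaf = leaf
  ... | inj₂ two  = ⊥-elim (¬twoChildren-of-one-kind true (top⇒children-viaRow top) two)

  complete∧leading⇒leaf : Complete M → ∀ {i j} → Leading1 M i j → Leaf M i j
  complete∧leading⇒leaf complete {i} {j} leading with complete i j (proj₁ leading)
  ... | inj₁ leaf = leaf
  ... | inj₂ two  = ⊥-elim (¬twoChildren-of-one-kind false (leading⇒children-viaColumn leading) two)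

enumerated-graph-size : ∀ {n m k} {G : Fin m → Fin k → Set} (f : Fin n → Fin m × Fin k) →
  Injective _≡_ _≡_ f → (∀ a → G (proj₁ (f a)) (proj₂ (f a))) →
  (∀ i j → G i j → ∃ λ a → f a ≡ (i , j)) →
  (∀ j → ∃ λ i → G i j) → (∀ {i i' j} → G i j → G i' j → i ≡ i') → k ≡ n
enumerated-graph-size {G = G} f f-inj f-in f-onto total functional =
  cantor-schröder-bernstein index-injective coordinate-injective
  where
  index : ∀ j → ∃ λ a → f a ≡ (proj₁ (total j) , j)
  index j = f-onto _ j (proj₂ (total j))

  index-injective : Injective _≡_ _≡_ (proj₁ ∘ index)
  index-injective {j} {j'} e = cong proj₂ (trans (sym (proj₂ (index j))) (trans (cong f e) (proj₂ (index j'))))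

  coordinate-injective : Injective _≡_ _≡_ (proj₂ ∘ f)
  coordinate-injective {a} {b} e =
    f-inj (×-≡,≡→≡ (functional (f-in a) (subst (G (proj₁ (f b))) (sym e) (f-in b)) , e))

complete-forest⇒square∧topOnesLeading : ∀ {r c n} (M : Mat r c) → IsCompleteNAFMatrix M n →
                                        r ≡ n × c ≡ n × TopOnesLeading M
complete-forest⇒square∧topOnesLeading {r} {c} {n} M ((Γ , nzr , nzc) , complete , (f , f-inj , f-leaf , f-onto)) =
  rows , columns , topOnesLeading
  where
  topOnesLeading : TopOnesLeading M
  topOnesLeading i j = leaf⇒leading M ∘ complete∧top⇒leaf M complete

  columns : c ≡ n
  columns = enumerated-graph-size f (λ {a} {b} → f-inj a b) f-leaf f-onto
    (λ j → let i , top = top-exists M nzc j in i , complete∧top⇒leaf M complete top)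
    (λ leaf leaf' → top-unique M (leaf⇒top M Γ leaf) (leaf⇒top M Γ leaf'))

  rows : r ≡ n
  rows = enumerated-graph-size {G = λ j i → Leaf M i j} (swap ∘ f) (λ e → f-inj _ _ (cong swap e)) f-leaf
    (λ j i leaf → let a , e = f-onto i j leaf in a , cong swap e)
    (λ i → let j , leading = leading-exists M nzr i in j , complete∧leading⇒leaf M complete leading)
    (λ leaf leaf' → leading-unique M (leaf⇒leading M leaf) (leaf⇒leading M leaf'))

module TopOnesLeadingSquare {n : ℕ} (M : Mat n n) (Γ : ΓFree M) (nzr : NoZeroRows M) (nzc : NoZeroCols M)
                            (topOnesLeading : TopOnesLeading M) where

  topRow : Fin n → Fin n
  topRow j = proj₁ (top-exists M nzc j)

  top : ∀ j → Top1 M (topRow j) j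
  top j = proj₂ (top-exists M nzc j)

  leadingColumn : Fin n → Fin n
  leadingColumn i = proj₁ (leading-exists M nzr i)

  leading : ∀ i → Leading1 M i (leadingColumn i)
  leading i = proj₂ (leading-exists M nzr i)

  topRow-injective : Injective _≡_ _≡_ topRow
  topRow-injective {j} {j'} e =
    leading-unique M (topOnesLeading _ j (top j)) (subst (λ i → Leading1 M i j') (sym e) (topOnesLeading _ j' (top j')))

  leading⇒top : ∀ {i j} → Leading1 M i j → Top1 M i j
  leading⇒top {i} leading-ij with injective⇒surjective topRow topRow-injective i
  ... | j , refl = subst (Top1 M i) (leading-unique M (topOnesLeading _ j (top j)) leading-ij) (top j)

  leaf⇔top : ∀ i j → Leaf M i j ⇔ Top1 M i j
  leaf⇔top i j = mk⇔ (leaf⇒top M Γ) λ top-ij → top∧leading⇒leaf M top-ij (topOnesLeading i j top-ij)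

  complete : Complete M
  complete i j oj with none-after⊎nextAfter (M i) j
  ... | inj₁ none-left = inj₁ (top∧leading⇒leaf M (leading⇒top (oj , none-left)) (oj , none-left))
  ... | inj₂ (l , left@(j<l , ol , _)) with none-after⊎nextAfter (column M j) i
  ...   | inj₁ none-above = ⊥-elim (not-¬ (proj₂ (topOnesLeading i j (oj , none-above)) l j<l) ol)
  ...   | inj₂ (k , above) = inj₂ (_ , _ , rowChild M oj left , columnChild M Γ oj above , distinct , only)
    where
    distinct : (i , l) ≢ (k , j)
    distinct e = <-irrefl (sym (cong proj₂ e)) j<l

    only : ∀ a b → Parent M a b i j → (a , b) ≡ (i , l) ⊎ (a , b) ≡ (k , j)
    only a b p with viaRow M p in kind
    ... | true  = inj₁ (children-of-same-kind-equal M p (rowChild M oj left) kind)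
    ... | false = inj₂ (children-of-same-kind-equal M p (columnChild M Γ oj above) kind)

  hasLeaves : HasLeaves M n
  hasLeaves = (λ i → i , leadingColumn i)
            , (λ _ _ → cong proj₁)
            , (λ i → top∧leading⇒leaf M (leading⇒top (leading i)) (leading i))
            , λ i j leaf → i , cong (i ,_) (leading-unique M (leading i) (leaf⇒leading M leaf))

  η : Permutation′ n
  η = permutation leadingColumn topRow
        (λ j → leading-unique M (leading _) (topOnesLeading _ j (top j)))
        (λ i → top-unique M (top _) (leading⇒top (leading i)))

  top⇔η : ∀ i j → Top1 M i j ⇔ (j ≡ η ⟨$⟩ʳ i)
  top⇔η i j = mk⇔ (λ top-ij → leading-unique M (topOnesLeading i j top-ij) (leading i))
                  (λ { refl → leading⇒top (leading i) })

lemma3 : (n : ℕ) → 1 ≤ n →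
    ((r c : ℕ) (M : Mat r c) →
       IsCompleteNAFMatrix M n ⇔
       (r ≡ n × c ≡ n × ΓFree M × NoZeroRows M × NoZeroCols M × TopOnesLeading M))
    ×
    ((M : Mat n n) → ΓFree M → NoZeroRows M → NoZeroCols M → TopOnesLeading M →
       ((i j : Fin n) → Leaf M i j ⇔ Top1 M i j) ×
       Σ (Permutation′ n) (λ η → (i j : Fin n) → Top1 M i j ⇔ (j ≡ η ⟨$⟩ʳ i)))
lemma3 n _ = (λ r c M → mk⇔ (forward M) (backward M)) , characterisation
  where
  forward : ∀ {r c} (M : Mat r c) → IsCompleteNAFMatrix M n →
            r ≡ n × c ≡ n × ΓFree M × NoZeroRows M × NoZeroCols M × TopOnesLeading M
  forward M forest@((Γ , nzr , nzc) , _) with complete-forest⇒square∧topOnesLeading M forest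
  ... | rows , columns , topOnesLeading = rows , columns , Γ , nzr , nzc , topOnesLeading

  backward : ∀ {r c} (M : Mat r c) →
             r ≡ n × c ≡ n × ΓFree M × NoZeroRows M × NoZeroCols M × TopOnesLeading M →
             IsCompleteNAFMatrix M n
  backward M (refl , refl , Γ , nzr , nzc , tol) =
    (Γ , nzr , nzc) , complete , hasLeaves
    where open TopOnesLeadingSquare M Γ nzr nzc tol

  characterisation : (M : Mat n n) → ΓFree M → NoZeroRows M → NoZeroCols M → TopOnesLeading M →
                     ((i j : Fin n) → Leaf M i j ⇔ Top1 M i j) ×
                     Σ (Permutation′ n) (λ η → (i j : Fin n) → Top1 M i j ⇔ (j ≡ η ⟨$⟩ʳ i))
  characterisation M Γ nzr nzc tol = leaf⇔top , η , top⇔η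
    where open TopOnesLeadingSquare M Γ nzr nzc tol
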